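{- Let $i,n$ be positive integers with $2\le i\le n$, and let $\sigma=\sigma_1\cdots\sigma_n\in\mathfrak S_n$ be such that $\sigma_i\sigma_{i+1}\cdots\sigma_n=i(i+1)\cdots n$. Then for every integer $j$ with $i\le j\le n$, $S(\sigma)_j=0$.
   Context: Let $\Bbbk$ be a field of characteristic zero. $\mathfrak S_n$ is the group of permutations of $[n]$, written in one-line notation as words; $\mathfrak S_0=\{\emptyset\}$ (empty word). The shuffle product $\sqcup\!\sqcup$ on the vector space spanned by words is bilinear with $\emptyset$ as unit and $au\sqcup\!\sqcup bv=a(u\sqcup\!\sqcup bv)+b(au\sqcup\!\sqcup v)$ for letters $a,b$ and words $u,v$. For a word $w$ with distinct letters, $\mathrm{st}(w)$ is the permutation with the same relative order; $w+m$ adds $m$ to each letter. In the Malvenuto–Reutenauer Hopf algebra $\bigoplus_{n\ge0}\Bbbk\mathfrak S_n$, the product is $\pi\cdot\sigma=\pi\sqcup\!\sqcup(\sigma+m)$ for $\pi\in\mathfrak S_m$, the coproduct is $\Delta(\pi)=\sum_{i=0}^m\mathrm{st}(\pi_1\cdots\pi_i)\otimes\mathrm{st}(\pi_{i+1}\cdots\pi_m)$, and the antipode satisfies $S(\emptyset)=\emptyset$ and $S(\sigma)=-\sum_{i=0}^{n-1}S(\mathrm{st}(\sigma_1\cdots\sigma_i))\cdot\mathrm{st}(\sigma_{i+1}\cdots\sigma_n)$ for $\sigma\in\mathfrak S_n$, $n\ge1$. For $\sigma\in\mathfrak S_n$ and $j\in[n]$, $S(\sigma)_j$ denotes the sum (with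 coefficients) of the terms of $S(\sigma)$ whose last letter is $j$. -}

module Defs where

open import Data.Nat using (ℕ; zero; suc; _+_; _<ᵇ_)
open import Data.Integer using (ℤ; 0ℤ; 1ℤ; -_) renaming (_+_ to _+ℤ_; _*_ to _*ℤ_)
open import Data.List using (List; []; _∷_; map; _++_; length; take; drop; upTo; concatMap; last; foldr)
open import Data.List.Properties using (≡-dec)
open import Data.Maybe using (Maybe; just; nothing)
open import Data.Product using (_×_; _,_)
open import Data.Bool using (Bool; true; false; if_then_else_)
import Data.Nat as ℕ
open import Relation.Nullary using (does)
open import Relation.Binary.PropositionalEquality using (_≡_)

Word : Set
Word = List ℕ

-- Formal ℤ-linear combinations of words (unreduced: a list of terms).
LinComb : Set
LinComb = List (ℤ × Word)

coeff : LinComb → Word → ℤ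
coeff []            w = 0ℤ
coeff ((c , u) ∷ t) w = if does (≡-dec ℕ._≟_ u w) then c +ℤ coeff t w else coeff t w

countLess : ℕ → Word → ℕ
countLess a []      = zero
countLess a (b ∷ w) = if b <ᵇ a then suc (countLess a w) else countLess a w

st : Word → Word
st w = map (λ a → suc (countLess a w)) w

shiftW : ℕ → Word → Word
shiftW m = map (_+ m)

-- Shuffle product of two words, as the list of resulting words (each with coefficient 1).
shuffle : Word → Word → List Word
shuffle []      v       = v ∷ []
shuffle (a ∷ u) []      = (a ∷ u) ∷ []
shuffle (a ∷ u) (b ∷ v) = map (a ∷_) (shuffle u (b ∷ v)) ++ map (b ∷_) (shuffle (a ∷ u) v)

-- Malvenuto–Reutenauer product on basis elements: π · σ = π ⧢ (σ + |π|).
mrProdW : Word → Word → List Word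
mrProdW π σ = shuffle π (shiftW (length π) σ)

mrProd : LinComb → LinComb → LinComb
mrProd x y = concatMap (λ { (c , π) → concatMap (λ { (d , σ) → map (λ w → (c *ℤ d , w)) (mrProdW π σ) }) y }) x

negLC : LinComb → LinComb
negLC = map (λ { (c , w) → (- c , w) })

-- Antipode, with fuel (fuel ≥ length of the word suffices).
-- S(∅) = ∅,  S(σ) = - Σ_{i=0}^{n-1} S(st(σ₁⋯σᵢ)) · st(σ_{i+1}⋯σₙ).
antipodeF : ℕ → Word → LinComb
antipodeF zero    σ       = (1ℤ , []) ∷ []
antipodeF (suc k) []      = (1ℤ , []) ∷ []
antipodeF (suc k) (a ∷ τ) =
  negLC (concatMap (λ i → mrProd (antipodeF k (st (take i σ))) ((1ℤ , st (drop i σ)) ∷ []))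
                   (upTo (length σ)))
  where σ = a ∷ τ

antipode : Word → LinComb
antipode σ = antipodeF (length σ) σ

-- S(σ)_j : the terms of S(σ) whose last letter is j.
lastPart : ℕ → LinComb → LinComb
lastPart j [] = []
lastPart j ((c , w) ∷ t) with last w
... | just a  = if does (a ℕ.≟ j) then (c , w) ∷ lastPart j t else lastPart j t
... | nothing = lastPart j t

IsZeroLC : LinComb → Set
IsZeroLC x = (w : Word) → coeff x w ≡ 0ℤ

range : ℕ → ℕ → Word
range a b = map (a +_) (upTo (suc b ℕ.∸ a))

{-# OPTIONS --safe #-}

-- Write σ = p (m+1) ⋯ n with p a permutation of [m], m = i − 1 ≥ 1, and induct on n − m.
-- Since the last letter n of σ is its maximum, in the recursion
-- S(σ) = − Σ_k S(st(σ₁⋯σ_k)) · st(σ_{k+1}⋯σ_n) every shifted suffix ends in n, while the terms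
-- of S(st(σ₁⋯σ_k)) are words of length k in the letters 1, …, k.
-- For j < n, a shuffle ends in j only through a term of S(st(σ₁⋯σ_k)) ending in j, so k ≥ j > m;
-- such a prefix has the same shape as σ, and its terms ending in j cancel by induction.
-- For j = n, erasing the final n matches the terms ending in n with the terms of
-- − Σ_{k ≤ n−1} S(st(σ₁⋯σ_k)) · st(σ_{k+1}⋯σ_{n−1}), whose last summand is S(σ₁⋯σ_{n−1}) itself;
-- by the recursion for S(σ₁⋯σ_{n−1}) this sum is zero.

module Submission where

open import Defs
open import Data.Bool using (Bool; true; false; if_then_else_; T)
open import Data.Empty using (⊥-elim)
open import Data.Integer using (ℤ; 0ℤ; 1ℤ; -_) renaming (_+_ to _+ℤ_; _*_ to _*ℤ_)
import Data.Integer.Properties as ℤP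
open import Data.Integer.Tactic.RingSolver using (solve-∀)
open import Data.List
  using (List; []; _∷_; _∷ʳ_; map; _++_; length; take; drop; last; applyUpTo; upTo; concat; concatMap)
open import Data.List.Properties
  using (≡-dec; ++-identityʳ; ++-assoc; ∷ʳ-injectiveˡ; map-++; map-cong-local; map-id; map-applyUpTo;
         length-map; length-take; length-drop; length-++; concatMap-++; take-all; drop-all; upTo-∷ʳ;
         take++drop≡id)
open import Data.List.Membership.Propositional using (_∈_)
open import Data.List.Membership.Propositional.Properties using (∈-upTo⁻)
open import Data.List.Relation.Unary.All as All using (All; []; _∷_)
import Data.List.Relation.Unary.All.Properties as AllP
open import Data.List.Relation.Unary.Any using (here; there)
open import Data.List.Relation.Binary.Permutation.Propositional as ↭ using (_↭_)
open import Data.List.Relation.Binary.Permutation.Propositional.Properties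
  using (++⁺ʳ; drop-mid; ∈-resp-↭; ↭-length)
open import Data.Maybe using (just; nothing)
import Data.Maybe.Properties as MaybeP
open import Data.Nat as ℕ using (ℕ; zero; suc; _+_; _∸_; _≤_; _<_; _<ᵇ_; z≤n; s≤s)
open import Data.Nat.Induction using (<-rec)
import Data.Nat.Properties as ℕP
open import Data.Product using (_×_; _,_; proj₂; ∃-syntax)
open import Function using (_∘_; _∘′_)
open import Relation.Nullary using (does; yes; no; ¬_)
open import Relation.Binary.PropositionalEquality

AllWords : (Word → Set) → LinComb → Set
AllWords P = All (P ∘ proj₂)

coeff-++ : ∀ X Y w → coeff (X ++ Y) w ≡ coeff X w +ℤ coeff Y w
coeff-++ []            Y w = sym (ℤP.+-identityˡ _)
coeff-++ ((c , u) ∷ X) Y w with does (≡-dec ℕ._≟_ u w)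
... | true  = trans (cong (c +ℤ_) (coeff-++ X Y w)) (sym (ℤP.+-assoc c _ _))
... | false = coeff-++ X Y w

coeff-negLC : ∀ X w → coeff (negLC X) w ≡ - coeff X w
coeff-negLC []            w = refl
coeff-negLC ((c , u) ∷ X) w with does (≡-dec ℕ._≟_ u w)
... | true  = trans (cong (- c +ℤ_) (coeff-negLC X w)) (sym (ℤP.neg-distrib-+ c _))
... | false = coeff-negLC X w

coeff-absent : ∀ w X → AllWords (_≢ w) X → coeff X w ≡ 0ℤ
coeff-absent w []            []           = refl
coeff-absent w ((c , π) ∷ X) (π≢w ∷ X≢w) rewrite ≢-≟-identity (≡-dec ℕ._≟_) π≢w =
  coeff-absent w X X≢w

coeff-concatMap-cong : ∀ (F G : ℕ → LinComb) ks {w w′} →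
                       All (λ k → coeff (F k) w ≡ coeff (G k) w′) ks →
                       coeff (concatMap F ks) w ≡ coeff (concatMap G ks) w′
coeff-concatMap-cong F G []       []             = refl
coeff-concatMap-cong F G (k ∷ ks) {w} {w′} (Fk≡Gk ∷ F≡G) =
  trans (coeff-++ (F k) (concatMap F ks) w)
    (trans (cong₂ _+ℤ_ Fk≡Gk (coeff-concatMap-cong F G ks F≡G))
           (sym (coeff-++ (G k) (concatMap G ks) w′)))

coeff-concatMap-0 : ∀ (F : ℕ → LinComb) ks {w} → All (λ k → coeff (F k) w ≡ 0ℤ) ks →
                    coeff (concatMap F ks) w ≡ 0ℤ
coeff-concatMap-0 F []       []           = refl
coeff-concatMap-0 F (k ∷ ks) {w} (Fk≡0 ∷ F≡0) =
  trans (coeff-++ (F k) (concatMap F ks) w) (cong₂ _+ℤ_ Fk≡0 (coeff-concatMap-0 F ks F≡0))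

coeff-concatMap-∷ʳ : ∀ (F : ℕ → LinComb) ks k w →
                     coeff (concatMap F (ks ∷ʳ k)) w ≡ coeff (concatMap F ks) w +ℤ coeff (F k) w
coeff-concatMap-∷ʳ F ks k w = begin
    coeff (concatMap F (ks ∷ʳ k)) w
  ≡⟨ cong (λ X → coeff X w) (concatMap-++ F ks (k ∷ [])) ⟩
    coeff (concatMap F ks ++ F k ++ []) w
  ≡⟨ coeff-++ (concatMap F ks) (F k ++ []) w ⟩
    coeff (concatMap F ks) w +ℤ coeff (F k ++ []) w
  ≡⟨ cong (λ X → coeff (concatMap F ks) w +ℤ coeff X w) (++-identityʳ (F k)) ⟩
    coeff (concatMap F ks) w +ℤ coeff (F k) w
  ∎
  where open ≡-Reasoning

count : Word → List Word → ℤ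
count w []      = 0ℤ
count w (u ∷ L) = if does (≡-dec ℕ._≟_ u w) then 1ℤ +ℤ count w L else count w L

coeff-map : ∀ c L w → coeff (map (c ,_) L) w ≡ c *ℤ count w L
coeff-map c []      w = sym (ℤP.*-zeroʳ c)
coeff-map c (u ∷ L) w with does (≡-dec ℕ._≟_ u w)
... | true  = trans (cong (c +ℤ_) (coeff-map c L w)) (distrib c (count w L))
  where distrib : ∀ a b → a +ℤ a *ℤ b ≡ a *ℤ (1ℤ +ℤ b)
        distrib = solve-∀
... | false = coeff-map c L w

linExt : (Word → ℤ) → LinComb → ℤ
linExt g []            = 0ℤ
linExt g ((c , π) ∷ X) = c *ℤ g π +ℤ linExt g X

linExt-cong : ∀ {g h} X → AllWords (λ π → g π ≡ h π) X → linExt g X ≡ linExt h X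
linExt-cong []            []           = refl
linExt-cong ((c , π) ∷ X) (gπ≡hπ ∷ g≡h) =
  cong₂ (λ a b → c *ℤ a +ℤ b) gπ≡hπ (linExt-cong X g≡h)

linExt-single : ∀ w X → linExt (λ π → count w (π ∷ [])) X ≡ coeff X w
linExt-single w []            = refl
linExt-single w ((c , π) ∷ X) with does (≡-dec ℕ._≟_ π w)
... | true  = cong₂ _+ℤ_ (trans (cong (c *ℤ_) (ℤP.+-identityʳ 1ℤ)) (ℤP.*-identityʳ c))
                         (linExt-single w X)
... | false = trans (cong (_+ℤ linExt (λ π → count w (π ∷ [])) X) (ℤP.*-zeroʳ c))
                    (trans (ℤP.+-identityˡ _) (linExt-single w X))

coeff-mrProd : ∀ X τ w →
               coeff (mrProd X ((1ℤ , τ) ∷ [])) w ≡ linExt (λ π → count w (mrProdW π τ)) X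
coeff-mrProd []            τ w = refl
coeff-mrProd ((c , π) ∷ X) τ w = begin
    coeff ((map (c *ℤ 1ℤ ,_) (mrProdW π τ) ++ []) ++ mrProd X ((1ℤ , τ) ∷ [])) w
  ≡⟨ coeff-++ (map (c *ℤ 1ℤ ,_) (mrProdW π τ) ++ []) _ w ⟩
    coeff (map (c *ℤ 1ℤ ,_) (mrProdW π τ) ++ []) w +ℤ coeff (mrProd X ((1ℤ , τ) ∷ [])) w
  ≡⟨ cong₂ _+ℤ_ (cong (λ Y → coeff Y w) (++-identityʳ (map (c *ℤ 1ℤ ,_) (mrProdW π τ))))
                (coeff-mrProd X τ w) ⟩
    coeff (map (c *ℤ 1ℤ ,_) (mrProdW π τ)) w +ℤ _
  ≡⟨ cong (_+ℤ _) (coeff-map (c *ℤ 1ℤ) (mrProdW π τ) w) ⟩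
    c *ℤ 1ℤ *ℤ count w (mrProdW π τ) +ℤ _
  ≡⟨ cong (λ a → a *ℤ count w (mrProdW π τ) +ℤ _) (ℤP.*-identityʳ c) ⟩
    c *ℤ count w (mrProdW π τ) +ℤ linExt (λ π → count w (mrProdW π τ)) X
  ∎
  where open ≡-Reasoning

dropWord : Word → LinComb → LinComb
dropWord π []            = []
dropWord π ((c , u) ∷ X) = if does (≡-dec ℕ._≟_ u π) then dropWord π X else (c , u) ∷ dropWord π X

linExt-dropWord : ∀ g π X → linExt g X ≡ coeff X π *ℤ g π +ℤ linExt g (dropWord π X)
linExt-dropWord g π []            = sym (trans (ℤP.+-identityʳ _) (ℤP.*-zeroˡ (g π)))
linExt-dropWord g π ((c , u) ∷ X) with ≡-dec ℕ._≟_ u π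
... | yes refl = trans (cong (c *ℤ g u +ℤ_) (linExt-dropWord g u X)) (collect c (coeff X u) (g u) _)
  where collect : ∀ a b x r → a *ℤ x +ℤ (b *ℤ x +ℤ r) ≡ (a +ℤ b) *ℤ x +ℤ r
        collect = solve-∀
... | no _     = trans (cong (c *ℤ g u +ℤ_) (linExt-dropWord g π X))
                       (swap (c *ℤ g u) (coeff X π *ℤ g π) (linExt g (dropWord π X)))
  where swap : ∀ a b r → a +ℤ (b +ℤ r) ≡ b +ℤ (a +ℤ r)
        swap = solve-∀

coeff-dropWord-≢ : ∀ π X w → w ≢ π → coeff (dropWord π X) w ≡ coeff X w
coeff-dropWord-≢ π []            w w≢π = refl
coeff-dropWord-≢ π ((c , u) ∷ X) w w≢π with ≡-dec ℕ._≟_ u π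
... | yes refl rewrite ≢-≟-identity (≡-dec ℕ._≟_) (w≢π ∘ sym) = coeff-dropWord-≢ π X w w≢π
... | no _     =
  cong (λ z → if does (≡-dec ℕ._≟_ u w) then c +ℤ z else z) (coeff-dropWord-≢ π X w w≢π)

coeff-dropWord-≡ : ∀ π X → coeff (dropWord π X) π ≡ 0ℤ
coeff-dropWord-≡ π []            = refl
coeff-dropWord-≡ π ((c , u) ∷ X) with ≡-dec ℕ._≟_ u π
... | yes _  = coeff-dropWord-≡ π X
... | no u≢π rewrite ≢-≟-identity (≡-dec ℕ._≟_) u≢π = coeff-dropWord-≡ π X

dropWord-IsZeroLC : ∀ π X → IsZeroLC X → IsZeroLC (dropWord π X)
dropWord-IsZeroLC π X X≈0 w with ≡-dec ℕ._≟_ w π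
... | yes refl = coeff-dropWord-≡ π X
... | no w≢π   = trans (coeff-dropWord-≢ π X w w≢π) (X≈0 w)

length-dropWord : ∀ π X → length (dropWord π X) ≤ length X
length-dropWord π []            = z≤n
length-dropWord π ((c , u) ∷ X) with does (≡-dec ℕ._≟_ u π)
... | true  = ℕP.m≤n⇒m≤1+n (length-dropWord π X)
... | false = s≤s (length-dropWord π X)

-- The terms of X may cancel each other, so the induction removes all terms of one word at a time.
linExt-IsZeroLC : ∀ g X → IsZeroLC X → linExt g X ≡ 0ℤ
linExt-IsZeroLC g X = go (length X) X ℕP.≤-refl
  where
  go : ∀ n X → length X ≤ n → IsZeroLC X → linExt g X ≡ 0ℤ
  go _       []            _          _   = refl
  go (suc n) ((c , π) ∷ X) (s≤s |X|≤n) X≈0 = begin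
      linExt g ((c , π) ∷ X)
    ≡⟨ linExt-dropWord g π ((c , π) ∷ X) ⟩
      coeff ((c , π) ∷ X) π *ℤ g π +ℤ linExt g (dropWord π ((c , π) ∷ X))
    ≡⟨ cong₂ (λ a b → a *ℤ g π +ℤ b) (X≈0 π)
             (go n (dropWord π ((c , π) ∷ X)) shorter (dropWord-IsZeroLC π ((c , π) ∷ X) X≈0)) ⟩
      0ℤ
    ∎
    where
    open ≡-Reasoning
    shorter : length (dropWord π ((c , π) ∷ X)) ≤ n
    shorter rewrite ≡-≟-identity (≡-dec ℕ._≟_) (refl {x = π}) =
      ℕP.≤-trans (length-dropWord π X) |X|≤n

-- In lastPart, does (a ℕ.≟ j) computes to a ℕ.≡ᵇ j, so the proofs below case on the latter.
≡ᵇ-true⇒≡ : ∀ {m n} → (m ℕ.≡ᵇ n) ≡ true → m ≡ n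
≡ᵇ-true⇒≡ {m} {n} m≡ᵇn = ℕP.≡ᵇ⇒≡ m n (subst T (sym m≡ᵇn) _)

≡ᵇ-false⇒≢ : ∀ {m n} → (m ℕ.≡ᵇ n) ≡ false → m ≢ n
≡ᵇ-false⇒≢ {m} {n} m≡ᵇn m≡n = subst T m≡ᵇn (ℕP.≡⇒≡ᵇ m n m≡n)

coeff-lastPart-ends : ∀ j X w → last w ≡ just j → coeff (lastPart j X) w ≡ coeff X w
coeff-lastPart-ends j []            w w↦j = refl
coeff-lastPart-ends j ((c , u) ∷ X) w w↦j with last u in u↦
... | nothing with ≡-dec ℕ._≟_ u w
...   | yes refl with () ← trans (sym u↦) w↦j
...   | no _     = coeff-lastPart-ends j X w w↦j
coeff-lastPart-ends j ((c , u) ∷ X) w w↦j | just a with a ℕ.≡ᵇ j in a≡ᵇj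
...   | true  =
  cong (λ z → if does (≡-dec ℕ._≟_ u w) then c +ℤ z else z) (coeff-lastPart-ends j X w w↦j)
...   | false with ≡-dec ℕ._≟_ u w
...     | yes refl = ⊥-elim (≡ᵇ-false⇒≢ a≡ᵇj (MaybeP.just-injective (trans (sym u↦) w↦j)))
...     | no _     = coeff-lastPart-ends j X w w↦j

coeff-lastPart-¬ends : ∀ j X w → last w ≢ just j → coeff (lastPart j X) w ≡ 0ℤ
coeff-lastPart-¬ends j []            w w↦̸j = refl
coeff-lastPart-¬ends j ((c , u) ∷ X) w w↦̸j with last u in u↦
... | nothing = coeff-lastPart-¬ends j X w w↦̸j
... | just a with a ℕ.≡ᵇ j in a≡ᵇj
...   | false = coeff-lastPart-¬ends j X w w↦̸j
...   | true with ≡-dec ℕ._≟_ u w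
...     | yes refl = ⊥-elim (w↦̸j (trans u↦ (cong just (≡ᵇ-true⇒≡ a≡ᵇj))))
...     | no _     = coeff-lastPart-¬ends j X w w↦̸j

lastPart-IsZeroLC : ∀ j X → (∀ w → last w ≡ just j → coeff X w ≡ 0ℤ) → IsZeroLC (lastPart j X)
lastPart-IsZeroLC j X vanish w with MaybeP.≡-dec ℕ._≟_ (last w) (just j)
... | yes w↦j = trans (coeff-lastPart-ends j X w w↦j) (vanish w w↦j)
... | no w↦̸j = coeff-lastPart-¬ends j X w w↦̸j

linExt-lastPart : ∀ j g X → AllWords (λ π → last π ≢ just j → g π ≡ 0ℤ) X →
                  linExt g X ≡ linExt g (lastPart j X)
linExt-lastPart j g []            []           = refl
linExt-lastPart j g ((c , u) ∷ X) (gu≡0 ∷ g≡0) with last u in u↦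
... | nothing rewrite gu≡0 (λ ()) | ℤP.*-zeroʳ c =
  trans (ℤP.+-identityˡ _) (linExt-lastPart j g X g≡0)
... | just a with a ℕ.≡ᵇ j in a≡ᵇj
...   | true  = cong (c *ℤ g u +ℤ_) (linExt-lastPart j g X g≡0)
...   | false rewrite gu≡0 (≡ᵇ-false⇒≢ a≡ᵇj ∘ MaybeP.just-injective) | ℤP.*-zeroʳ c =
          trans (ℤP.+-identityˡ _) (linExt-lastPart j g X g≡0)

private variable
  E : Set

last-∷-≢ : ∀ {a x : E} (u : List E) → last (a ∷ u) ≢ just x → last u ≢ just x
last-∷-≢ []      _ ()
last-∷-≢ (_ ∷ _) ≢x = ≢x

last-∷ʳ : ∀ (w : List E) x → last (w ∷ʳ x) ≡ just x
last-∷ʳ []          x = refl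
last-∷ʳ (_ ∷ [])    x = refl
last-∷ʳ (_ ∷ b ∷ w) x = last-∷ʳ (b ∷ w) x

length-∷ʳ : ∀ (w : List E) x → length (w ∷ʳ x) ≡ suc (length w)
length-∷ʳ w x = trans (length-++ w) (ℕP.+-comm _ 1)

last⇒∷ʳ : ∀ (w : List E) {y} → last w ≡ just y → ∃[ w′ ] w ≡ w′ ∷ʳ y
last⇒∷ʳ (a ∷ [])    refl = [] , refl
last⇒∷ʳ (a ∷ b ∷ w) w↦y with w′ , eq ← last⇒∷ʳ (b ∷ w) w↦y = a ∷ w′ , cong (a ∷_) eq

last-∈ : ∀ (w : List E) {y} → last w ≡ just y → y ∈ w
last-∈ (a ∷ [])    refl = here refl
last-∈ (a ∷ b ∷ w) w↦y  = there (last-∈ (b ∷ w) w↦y)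

take-++ˡ : ∀ {k} (xs ys : List E) → k ≤ length xs → take k (xs ++ ys) ≡ take k xs
take-++ˡ {k = zero}  xs       ys _         = refl
take-++ˡ {k = suc k} (x ∷ xs) ys (s≤s k≤n) = cong (x ∷_) (take-++ˡ xs ys k≤n)

take-++ʳ : ∀ k (xs ys : List E) → take (length xs + k) (xs ++ ys) ≡ xs ++ take k ys
take-++ʳ k []       ys = refl
take-++ʳ k (x ∷ xs) ys = cong (x ∷_) (take-++ʳ k xs ys)

drop-++ˡ : ∀ {k} (xs ys : List E) → k ≤ length xs → drop k (xs ++ ys) ≡ drop k xs ++ ys
drop-++ˡ {k = zero}  xs       ys _         = refl
drop-++ˡ {k = suc k} (x ∷ xs) ys (s≤s k≤n) = drop-++ˡ xs ys k≤n

++-cancelʳ-↭ : ∀ (xs ys zs : List E) → xs ++ zs ↭ ys ++ zs → xs ↭ ys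
++-cancelʳ-↭ xs ys []       xs↭ys = subst₂ _↭_ (++-identityʳ xs) (++-identityʳ ys) xs↭ys
++-cancelʳ-↭ xs ys (z ∷ zs) p     = ++-cancelʳ-↭ xs ys zs (drop-mid xs ys p)

when : Bool → ℤ → ℤ
when b z = if b then z else 0ℤ

when-0 : ∀ b {z} → z ≡ 0ℤ → when b z ≡ 0ℤ
when-0 true  z≡0 = z≡0
when-0 false _   = refl

count-++ : ∀ w L M → count w (L ++ M) ≡ count w L +ℤ count w M
count-++ w []      M = sym (ℤP.+-identityˡ _)
count-++ w (u ∷ L) M with does (≡-dec ℕ._≟_ u w)
... | true  = trans (cong (1ℤ +ℤ_) (count-++ w L M)) (sym (ℤP.+-assoc 1ℤ (count w L) (count w M)))
... | false = count-++ w L M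

count-[]-map-∷ : ∀ a L → count [] (map (a ∷_) L) ≡ 0ℤ
count-[]-map-∷ a []      = refl
count-[]-map-∷ a (u ∷ L) = count-[]-map-∷ a L

count-∷-map-∷ : ∀ c w a L → count (c ∷ w) (map (a ∷_) L) ≡ when (a ℕ.≡ᵇ c) (count w L)
count-∷-map-∷ c w a L with a ℕ.≡ᵇ c in a≡ᵇc
... | true  = go L
  where go : ∀ L → count (c ∷ w) (map (a ∷_) L) ≡ count w L
        go []      = refl
        go (u ∷ L) rewrite a≡ᵇc with does (≡-dec ℕ._≟_ u w)
        ... | true  = cong (1ℤ +ℤ_) (go L)
        ... | false = go L
... | false = go L
  where go : ∀ L → count (c ∷ w) (map (a ∷_) L) ≡ 0ℤ
        go []      = refl
        go (u ∷ L) rewrite a≡ᵇc = go L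

count-single-≢ : ∀ v w → v ≢ w → count w (v ∷ []) ≡ 0ℤ
count-single-≢ v w v≢w rewrite ≢-≟-identity (≡-dec ℕ._≟_) v≢w = refl

shuffle-[]ʳ : ∀ u → shuffle u [] ≡ u ∷ []
shuffle-[]ʳ []      = refl
shuffle-[]ʳ (a ∷ u) = refl

count-∷-shuffle : ∀ c w a u b v →
  count (c ∷ w) (shuffle (a ∷ u) (b ∷ v)) ≡
  when (a ℕ.≡ᵇ c) (count w (shuffle u (b ∷ v))) +ℤ when (b ℕ.≡ᵇ c) (count w (shuffle (a ∷ u) v))
count-∷-shuffle c w a u b v = trans (count-++ (c ∷ w) (map (a ∷_) (shuffle u (b ∷ v))) _)
  (cong₂ _+ℤ_ (count-∷-map-∷ c w a (shuffle u (b ∷ v))) (count-∷-map-∷ c w b (shuffle (a ∷ u) v)))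

count-[]-shuffle : ∀ a u b v → count [] (shuffle (a ∷ u) (b ∷ v)) ≡ 0ℤ
count-[]-shuffle a u b v = trans (count-++ [] (map (a ∷_) (shuffle u (b ∷ v))) _)
  (cong₂ _+ℤ_ (count-[]-map-∷ a (shuffle u (b ∷ v))) (count-[]-map-∷ b (shuffle (a ∷ u) v)))

count-[]-shuffleʳ : ∀ u b v → count [] (shuffle u (b ∷ v)) ≡ 0ℤ
count-[]-shuffleʳ []      b v = refl
count-[]-shuffleʳ (a ∷ u) b v = count-[]-shuffle a u b v

count-[]-shuffleˡ : ∀ a u v → count [] (shuffle (a ∷ u) v) ≡ 0ℤ
count-[]-shuffleˡ a u []      = refl
count-[]-shuffleˡ a u (b ∷ v) = count-[]-shuffle a u b v

count-shuffle-last≢ : ∀ {x} u v w → last u ≢ just x → last v ≢ just x → last w ≡ just x →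
                      count w (shuffle u v) ≡ 0ℤ
count-shuffle-last≢ []      v       w        _   v≢x w≡x = count-single-≢ v w λ { refl → v≢x w≡x }
count-shuffle-last≢ (a ∷ u) []      w        u≢x _   w≡x =
  count-single-≢ (a ∷ u) w λ { refl → u≢x w≡x }
count-shuffle-last≢ (a ∷ u) (b ∷ v) (c ∷ []) _   _   _   = trans (count-∷-shuffle c [] a u b v)
  (cong₂ _+ℤ_ (when-0 (a ℕ.≡ᵇ c) (count-[]-shuffleʳ u b v))
              (when-0 (b ℕ.≡ᵇ c) (count-[]-shuffleˡ a u v)))
count-shuffle-last≢ (a ∷ u) (b ∷ v) (c ∷ w@(_ ∷ _)) u≢x v≢x w≡x =
  trans (count-∷-shuffle c w a u b v)
  (cong₂ _+ℤ_ (when-0 (a ℕ.≡ᵇ c) (count-shuffle-last≢ u (b ∷ v) w (last-∷-≢ u u≢x) v≢x w≡x))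
              (when-0 (b ℕ.≡ᵇ c) (count-shuffle-last≢ (a ∷ u) v w u≢x (last-∷-≢ v v≢x) w≡x)))

count-single-∷ʳ : ∀ v w x → count (w ∷ʳ x) ((v ∷ʳ x) ∷ []) ≡ count w (v ∷ [])
count-single-∷ʳ v w x with ≡-dec ℕ._≟_ (v ∷ʳ x) (w ∷ʳ x) | ≡-dec ℕ._≟_ v w
... | yes _     | yes _    = refl
... | yes vx≡wx | no v≢w   = ⊥-elim (v≢w (∷ʳ-injectiveˡ v w vx≡wx))
... | no vx≢wx  | yes refl = ⊥-elim (vx≢wx refl)
... | no _      | no _     = refl

count-shuffle-∷ʳ : ∀ {x} u v w → last u ≢ just x →
                   count (w ∷ʳ x) (shuffle u (v ∷ʳ x)) ≡ count w (shuffle u v)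
count-shuffle-∷ʳ {x} [] v w _ = count-single-∷ʳ v w x
count-shuffle-∷ʳ {x} (a ∷ u) [] [] u≢x = trans (count-∷-shuffle x [] a u x [])
  (cong₂ _+ℤ_ (when-0 (a ℕ.≡ᵇ x) (count-[]-shuffleʳ u x [])) (when-0 (x ℕ.≡ᵇ x) refl))
count-shuffle-∷ʳ {x} (a ∷ u) [] (c ∷ w) u≢x = begin
    count (c ∷ w ∷ʳ x) (shuffle (a ∷ u) (x ∷ []))
  ≡⟨ count-∷-shuffle c (w ∷ʳ x) a u x [] ⟩
    when (a ℕ.≡ᵇ c) (count (w ∷ʳ x) (shuffle u (x ∷ []))) +ℤ
    when (x ℕ.≡ᵇ c) (count (w ∷ʳ x) ((a ∷ u) ∷ []))
  ≡⟨ cong₂ _+ℤ_ (cong (when (a ℕ.≡ᵇ c)) (trans (count-shuffle-∷ʳ u [] w (last-∷-≢ u u≢x))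
                                                (cong (count w) (shuffle-[]ʳ u))))
                (when-0 (x ℕ.≡ᵇ c) (count-single-≢ (a ∷ u) (w ∷ʳ x) au≢wx)) ⟩
    when (a ℕ.≡ᵇ c) (count w (u ∷ [])) +ℤ 0ℤ
  ≡⟨ ℤP.+-identityʳ _ ⟩
    when (a ℕ.≡ᵇ c) (count w (u ∷ []))
  ≡⟨ count-∷-map-∷ c w a (u ∷ []) ⟨
    count (c ∷ w) (shuffle (a ∷ u) [])
  ∎
  where
  open ≡-Reasoning
  au≢wx : a ∷ u ≢ w ∷ʳ x
  au≢wx eq = u≢x (trans (cong last eq) (last-∷ʳ w x))
count-shuffle-∷ʳ {x} (a ∷ u) (b ∷ v) [] u≢x = trans (count-∷-shuffle x [] a u b (v ∷ʳ x))
  (trans (cong₂ _+ℤ_ (when-0 (a ℕ.≡ᵇ x) (count-[]-shuffleʳ u b (v ∷ʳ x)))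
                     (when-0 (b ℕ.≡ᵇ x) (count-[]-shuffleˡ a u (v ∷ʳ x))))
         (sym (count-[]-shuffle a u b v)))
count-shuffle-∷ʳ {x} (a ∷ u) (b ∷ v) (c ∷ w) u≢x = begin
    count (c ∷ w ∷ʳ x) (shuffle (a ∷ u) (b ∷ v ∷ʳ x))
  ≡⟨ count-∷-shuffle c (w ∷ʳ x) a u b (v ∷ʳ x) ⟩
    when (a ℕ.≡ᵇ c) (count (w ∷ʳ x) (shuffle u (b ∷ v ∷ʳ x))) +ℤ
    when (b ℕ.≡ᵇ c) (count (w ∷ʳ x) (shuffle (a ∷ u) (v ∷ʳ x)))
  ≡⟨ cong₂ _+ℤ_ (cong (when (a ℕ.≡ᵇ c)) (count-shuffle-∷ʳ u (b ∷ v) w (last-∷-≢ u u≢x)))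
                (cong (when (b ℕ.≡ᵇ c)) (count-shuffle-∷ʳ (a ∷ u) v w u≢x)) ⟩
    when (a ℕ.≡ᵇ c) (count w (shuffle u (b ∷ v))) +ℤ when (b ℕ.≡ᵇ c) (count w (shuffle (a ∷ u) v))
  ≡⟨ count-∷-shuffle c w a u b v ⟨
    count (c ∷ w) (shuffle (a ∷ u) (b ∷ v))
  ∎
  where open ≡-Reasoning

shuffle-All : ∀ {P : ℕ → Set} u v → All P u → All P v → All (All P) (shuffle u v)
shuffle-All []      v       _            Pv           = Pv ∷ []
shuffle-All (a ∷ u) []      Pu           _            = Pu ∷ []
shuffle-All (a ∷ u) (b ∷ v) (Pa ∷ Pu) (Pb ∷ Pv) =
  AllP.++⁺ (AllP.map⁺ (All.map (Pa ∷_) (shuffle-All u (b ∷ v) Pu (Pb ∷ Pv))))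
           (AllP.map⁺ (All.map (Pb ∷_) (shuffle-All (a ∷ u) v (Pa ∷ Pu) Pv)))

length-shuffle : ∀ u v → All (λ w → length w ≡ length u + length v) (shuffle u v)
length-shuffle []      v       = refl ∷ []
length-shuffle (a ∷ u) []      = cong suc (sym (ℕP.+-identityʳ _)) ∷ []
length-shuffle (a ∷ u) (b ∷ v) =
  AllP.++⁺ (AllP.map⁺ (All.map (cong suc) (length-shuffle u (b ∷ v))))
           (AllP.map⁺ (All.map (λ eq → cong suc (trans eq (sym (ℕP.+-suc _ _)))) (length-shuffle (a ∷ u) v)))

<ᵇ-true : ∀ {a b} → a < b → (a <ᵇ b) ≡ true
<ᵇ-true {a} {b} a<b with a <ᵇ b in a<ᵇb
... | true  = refl
... | false = ⊥-elim (subst T a<ᵇb (ℕP.<⇒<ᵇ a<b))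

<ᵇ-false : ∀ {a b} → ¬ a < b → (a <ᵇ b) ≡ false
<ᵇ-false {a} {b} a≮b with a <ᵇ b in a<ᵇb
... | true  = ⊥-elim (a≮b (ℕP.<ᵇ⇒< a b (subst T (sym a<ᵇb) _)))
... | false = refl

countLess-++ : ∀ a u v → countLess a (u ++ v) ≡ countLess a u + countLess a v
countLess-++ a []      v = refl
countLess-++ a (b ∷ u) v with b <ᵇ a
... | true  = cong suc (countLess-++ a u v)
... | false = countLess-++ a u v

countLess-all< : ∀ {a} u → All (_< a) u → countLess a u ≡ length u
countLess-all< []      []           = refl
countLess-all< (b ∷ u) (b<a ∷ u<a) rewrite <ᵇ-true b<a = cong suc (countLess-all< u u<a)

countLess-all≥ : ∀ {a} u → All (a ≤_) u → countLess a u ≡ 0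
countLess-all≥ []      []           = refl
countLess-all≥ (b ∷ u) (a≤b ∷ a≤u) rewrite <ᵇ-false (ℕP.≤⇒≯ a≤b) = countLess-all≥ u a≤u

countLess-≤ : ∀ a u → countLess a u ≤ length u
countLess-≤ a []      = z≤n
countLess-≤ a (b ∷ u) with b <ᵇ a
... | true  = s≤s (countLess-≤ a u)
... | false = ℕP.m≤n⇒m≤1+n (countLess-≤ a u)

countLess-< : ∀ {a} u → a ∈ u → countLess a u < length u
countLess-< {a} (b ∷ u) (here refl) rewrite <ᵇ-false (ℕP.<-irrefl (refl {x = a})) =
  s≤s (countLess-≤ a u)
countLess-< {a} (b ∷ u) (there a∈u) with b <ᵇ a
... | true  = s≤s (countLess-< u a∈u)
... | false = ℕP.m≤n⇒m≤1+n (countLess-< u a∈u)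

countLess-↭ : ∀ a {u v} → u ↭ v → countLess a u ≡ countLess a v
countLess-↭ a ↭.refl           = refl
countLess-↭ a (↭.prep b u↭v) with b <ᵇ a
... | true  = cong suc (countLess-↭ a u↭v)
... | false = countLess-↭ a u↭v
countLess-↭ a (↭.swap b c u↭v) with b <ᵇ a | c <ᵇ a
... | true  | true  = cong (suc ∘′ suc) (countLess-↭ a u↭v)
... | true  | false = cong suc (countLess-↭ a u↭v)
... | false | true  = cong suc (countLess-↭ a u↭v)
... | false | false = countLess-↭ a u↭v
countLess-↭ a (↭.trans u↭v v↭w) = trans (countLess-↭ a u↭v) (countLess-↭ a v↭w)

length-st : ∀ u → length (st u) ≡ length u
length-st u = length-map _ u

st-≤-length : ∀ u → All (_≤ length u) (st u)
st-≤-length u = AllP.map⁺ (All.tabulate (countLess-< u))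

st-∷ʳ : ∀ {x} u → All (_< x) u → st (u ∷ʳ x) ≡ st u ∷ʳ suc (length u)
st-∷ʳ {x} u u<x = trans (map-++ _ u (x ∷ []))
  (cong₂ _++_ (map-cong-local (All.map (λ a<x → cong suc (ignore-x (ℕP.<⇒≯ a<x))) u<x))
              (cong (λ c → suc c ∷ []) (trans (ignore-x (ℕP.<-irrefl refl)) (countLess-all< u u<x))))
  where
  ignore-x : ∀ {a} → ¬ x < a → countLess a (u ∷ʳ x) ≡ countLess a u
  ignore-x {a} x≮a rewrite countLess-++ a u (x ∷ []) | <ᵇ-false x≮a = ℕP.+-identityʳ _

interval : ℕ → ℕ → Word
interval s zero    = []
interval s (suc l) = s ∷ interval (suc s) l

applyUpTo≡interval : ∀ (f : ℕ → ℕ) s l → (∀ i → f i ≡ s + i) → applyUpTo f l ≡ interval s l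
applyUpTo≡interval f s zero    f≗s+ = refl
applyUpTo≡interval f s (suc l) f≗s+ = cong₂ _∷_ (trans (f≗s+ 0) (ℕP.+-identityʳ s))
  (applyUpTo≡interval (f ∘′ suc) (suc s) l (λ i → trans (f≗s+ (suc i)) (ℕP.+-suc s i)))

range≡interval : ∀ a b → range a b ≡ interval a (suc b ∸ a)
range≡interval a b =
  trans (map-applyUpTo (λ i → i) (a +_) (suc b ∸ a)) (applyUpTo≡interval (a +_) a _ (λ _ → refl))

length-interval : ∀ s l → length (interval s l) ≡ l
length-interval s zero    = refl
length-interval s (suc l) = cong suc (length-interval (suc s) l)

interval-++ : ∀ s l₁ l₂ → interval s (l₁ + l₂) ≡ interval s l₁ ++ interval (s + l₁) l₂
interval-++ s zero     l₂ = cong (λ t → interval t l₂) (sym (ℕP.+-identityʳ s))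
interval-++ s (suc l₁) l₂ = cong (s ∷_) (trans (interval-++ (suc s) l₁ l₂)
  (cong (λ t → interval (suc s) l₁ ++ interval t l₂) (sym (ℕP.+-suc s l₁))))

interval-∷ʳ : ∀ s l → interval s (suc l) ≡ interval s l ∷ʳ (s + l)
interval-∷ʳ s l = trans (cong (interval s) (ℕP.+-comm 1 l)) (interval-++ s l 1)

take-interval : ∀ s {k l} → k ≤ l → take k (interval s l) ≡ interval s k
take-interval s {zero}          _         = refl
take-interval s {suc k} {suc l} (s≤s k≤l) = cong (s ∷_) (take-interval (suc s) k≤l)

∈-interval⁻ : ∀ {a} s l → a ∈ interval s l → ∃[ i ] i < l × a ≡ s + i
∈-interval⁻ s (suc l) (here a≡s)  = 0 , s≤s z≤n , trans a≡s (sym (ℕP.+-identityʳ s))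
∈-interval⁻ s (suc l) (there a∈) with ∈-interval⁻ (suc s) l a∈
... | i , i<l , a≡ = suc i , s≤s i<l , trans a≡ (sym (ℕP.+-suc s i))

countLess-interval : ∀ s i r → countLess (s + i) (interval s (i + r)) ≡ i
countLess-interval s i r = begin
    countLess (s + i) (interval s (i + r))
  ≡⟨ cong (countLess (s + i)) (interval-++ s i r) ⟩
    countLess (s + i) (interval s i ++ interval (s + i) r)
  ≡⟨ countLess-++ (s + i) (interval s i) (interval (s + i) r) ⟩
    countLess (s + i) (interval s i) + countLess (s + i) (interval (s + i) r)
  ≡⟨ cong₂ _+_ (trans (countLess-all< (interval s i) (All.tabulate below)) (length-interval s i))
               (countLess-all≥ (interval (s + i) r) (All.tabulate above)) ⟩
    i + 0
  ≡⟨ ℕP.+-identityʳ i ⟩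
    i
  ∎
  where
  below : ∀ {a} → a ∈ interval s i → a < s + i
  below a∈ with j , j<i , refl ← ∈-interval⁻ s i a∈ = ℕP.+-monoʳ-< s j<i
  above : ∀ {a} → a ∈ interval (s + i) r → s + i ≤ a
  above a∈ with j , _ , refl ← ∈-interval⁻ (s + i) r a∈ = ℕP.m≤m+n (s + i) j
  open ≡-Reasoning

st-↭-interval : ∀ {m} u → u ↭ interval 1 m → st u ≡ u
st-↭-interval {m} u u↭ = trans (map-cong-local (All.tabulate rank)) (map-id u)
  where
  rank : ∀ {a} → a ∈ u → suc (countLess a u) ≡ a
  rank a∈u with i , i<m , refl ← ∈-interval⁻ 1 m (∈-resp-↭ u↭ a∈u) = cong suc (begin
      countLess (suc i) u
    ≡⟨ countLess-↭ (suc i) u↭ ⟩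
      countLess (suc i) (interval 1 m)
    ≡⟨ cong (λ l → countLess (suc i) (interval 1 l)) (ℕP.m+[n∸m]≡n (ℕP.<⇒≤ i<m)) ⟨
      countLess (1 + i) (interval 1 (i + (m ∸ i)))
    ≡⟨ countLess-interval 1 i (m ∸ i) ⟩
      i
    ∎)
    where open ≡-Reasoning

-- The recursion for the antipode

Graded : ℕ → Word → Set
Graded k π = length π ≡ k × All (_≤ k) π

mrProdW-Graded : ∀ {k t} π τ → Graded k π → Graded t τ → All (Graded (k + t)) (mrProdW π τ)
mrProdW-Graded {k} {t} π τ (|π|≡k , π≤k) (|τ|≡t , τ≤t) =
  All.zipWith (λ (|w|≡ , w≤) → trans |w|≡ (cong₂ _+_ |π|≡k |shiftτ|≡t) , w≤)
              (length-shuffle π shiftτ , shuffle-All π shiftτ π≤k+t shiftτ≤k+t)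
  where
  shiftτ = shiftW (length π) τ
  |shiftτ|≡t : length shiftτ ≡ t
  |shiftτ|≡t = trans (length-map _ τ) |τ|≡t
  π≤k+t : All (_≤ k + t) π
  π≤k+t = All.map (λ a≤k → ℕP.≤-trans a≤k (ℕP.m≤m+n k t)) π≤k
  shiftτ≤k+t : All (_≤ k + t) shiftτ
  shiftτ≤k+t = AllP.map⁺ (All.map (λ {b} b≤t → subst (λ l → b + l ≤ k + t) (sym |π|≡k)
                                     (subst (b + k ≤_) (ℕP.+-comm t k) (ℕP.+-monoˡ-≤ k b≤t))) τ≤t)

mrProd-Graded : ∀ {k t} X τ → AllWords (Graded k) X → Graded t τ →
                AllWords (Graded (k + t)) (mrProd X ((1ℤ , τ) ∷ []))
mrProd-Graded []            τ []                    τ-graded = []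
mrProd-Graded ((c , π) ∷ X) τ (π-graded ∷ X-graded) τ-graded =
  AllP.++⁺ (AllP.++⁺ (AllP.map⁺ (mrProdW-Graded π τ π-graded τ-graded)) [])
           (mrProd-Graded X τ X-graded τ-graded)

Graded-last≢ : ∀ {k n π} → Graded k π → k < n → last π ≢ just n
Graded-last≢ {π = π} (_ , π≤k) k<n π↦n = ℕP.<⇒≱ k<n (All.lookup π≤k (last-∈ π π↦n))

antipodeTerm : Word → ℕ → LinComb
antipodeTerm σ k = mrProd (antipode (st (take k σ))) ((1ℤ , st (drop k σ)) ∷ [])

length-st-take : ∀ {k} σ → k ≤ length σ → length (st (take k σ)) ≡ k
length-st-take {k} σ k≤|σ| =
  trans (length-st (take k σ)) (trans (length-take k σ) (ℕP.m≤n⇒m⊓n≡m k≤|σ|))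

length-st-take-< : ∀ {k K} a τ → k < suc (length τ) → length τ ≤ K →
                   length (st (take k (a ∷ τ))) ≤ K
length-st-take-< a τ (s≤s k≤|τ|) |τ|≤K =
  subst (_≤ _) (sym (length-st-take (a ∷ τ) (ℕP.m≤n⇒m≤1+n k≤|τ|))) (ℕP.≤-trans k≤|τ| |τ|≤K)

antipodeF-∷-cong : ∀ K a τ {F : ℕ → LinComb} →
  (∀ {k} → k < suc (length τ) → antipodeF K (st (take k (a ∷ τ))) ≡ F k) →
  antipodeF (suc K) (a ∷ τ) ≡
  negLC (concatMap (λ k → mrProd (F k) ((1ℤ , st (drop k (a ∷ τ))) ∷ [])) (upTo (suc (length τ))))
antipodeF-∷-cong K a τ prefix≡ = cong (negLC ∘′ concat) (map-cong-local (All.tabulate λ {k} k∈ →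
  cong (λ A → mrProd A ((1ℤ , st (drop k (a ∷ τ))) ∷ [])) (prefix≡ (∈-upTo⁻ k∈))))

antipodeF-fuel : ∀ K K′ u → length u ≤ K → length u ≤ K′ → antipodeF K u ≡ antipodeF K′ u
antipodeF-fuel zero    zero     []      _ _ = refl
antipodeF-fuel zero    (suc K′) []      _ _ = refl
antipodeF-fuel (suc K) zero     []      _ _ = refl
antipodeF-fuel (suc K) (suc K′) []      _ _ = refl
antipodeF-fuel (suc K) (suc K′) (a ∷ τ) (s≤s |τ|≤K) (s≤s |τ|≤K′) =
  antipodeF-∷-cong K a τ λ k<|σ| →
    antipodeF-fuel K K′ _ (length-st-take-< a τ k<|σ| |τ|≤K) (length-st-take-< a τ k<|σ| |τ|≤K′)

antipode-unfold : ∀ σ → 0 < length σ → antipode σ ≡ negLC (concatMap (antipodeTerm σ) (upTo (length σ)))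
antipode-unfold (a ∷ τ) _ = antipodeF-∷-cong (length τ) a τ λ k<|σ| →
  antipodeF-fuel _ _ _ (length-st-take-< a τ k<|σ| ℕP.≤-refl) ℕP.≤-refl

coeff-antipode : ∀ σ w → 0 < length σ →
                 coeff (antipode σ) w ≡ - coeff (concatMap (antipodeTerm σ) (upTo (length σ))) w
coeff-antipode σ w 0<|σ| = trans (cong (λ X → coeff X w) (antipode-unfold σ 0<|σ|))
                                 (coeff-negLC (concatMap (antipodeTerm σ) (upTo (length σ))) w)

coeff-antipode-∷ʳ : ∀ σ x w →
  coeff (antipode (σ ∷ʳ x)) w ≡ - coeff (concatMap (antipodeTerm (σ ∷ʳ x)) (upTo (suc (length σ)))) w
coeff-antipode-∷ʳ σ x w =
  trans (coeff-antipode (σ ∷ʳ x) w (subst (0 <_) (sym (length-∷ʳ σ x)) (s≤s z≤n)))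
  (cong (λ l → - coeff (concatMap (antipodeTerm (σ ∷ʳ x)) (upTo l)) w) (length-∷ʳ σ x))

antipodeTerm-Graded : ∀ {k} σ → k ≤ length σ →
                      AllWords (Graded (length (st (take k σ)))) (antipode (st (take k σ))) →
                      AllWords (Graded (length σ)) (antipodeTerm σ k)
antipodeTerm-Graded {k} σ k≤|σ| prefix-graded =
  subst (λ n → AllWords (Graded n) (antipodeTerm σ k))
        (trans (cong (k +_) (length-drop k σ)) (ℕP.m+[n∸m]≡n k≤|σ|))
    (mrProd-Graded (antipode (st (take k σ))) (st (drop k σ))
      (subst (λ n → AllWords (Graded n) (antipode (st (take k σ)))) (length-st-take σ k≤|σ|) prefix-graded)
      (length-st (drop k σ) , st-≤-length (drop k σ)))

antipode-Graded : ∀ u → AllWords (Graded (length u)) (antipode u)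
antipode-Graded u = go (length u) u ℕP.≤-refl
  where
  go : ∀ K u → length u ≤ K → AllWords (Graded (length u)) (antipode u)
  go _       []      _           = (refl , []) ∷ []
  go (suc K) (a ∷ τ) (s≤s |τ|≤K) rewrite antipode-unfold (a ∷ τ) (s≤s z≤n) =
    AllP.map⁺ (AllP.concat⁺ (AllP.map⁺ (All.tabulate λ {k} k∈ → let k<|σ| = ∈-upTo⁻ k∈ in
      antipodeTerm-Graded (a ∷ τ) (ℕP.<⇒≤ k<|σ|)
                          (go K (st (take k (a ∷ τ))) (length-st-take-< a τ k<|σ| |τ|≤K)))))

antipode-st-take-Graded : ∀ {k} σ → k ≤ length σ → AllWords (Graded k) (antipode (st (take k σ)))
antipode-st-take-Graded {k} σ k≤|σ| = subst (λ n → AllWords (Graded n) (antipode (st (take k σ))))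
                                            (length-st-take σ k≤|σ|) (antipode-Graded (st (take k σ)))

coeff-antipodeTerm-length : ∀ σ w → st σ ≡ σ →
                            coeff (antipodeTerm σ (length σ)) w ≡ coeff (antipode σ) w
coeff-antipodeTerm-length σ w stσ≡σ = begin
    coeff (antipodeTerm σ (length σ)) w
  ≡⟨ coeff-mrProd (antipode (st (take (length σ) σ))) (st (drop (length σ) σ)) w ⟩
    linExt (λ π → count w (mrProdW π (st (drop (length σ) σ)))) (antipode (st (take (length σ) σ)))
  ≡⟨ cong₂ (λ u v → linExt (λ π → count w (mrProdW π (st v))) (antipode u))
           (trans (cong st (take-all (length σ) σ ℕP.≤-refl)) stσ≡σ)
           (drop-all (length σ) σ ℕP.≤-refl) ⟩
    linExt (λ π → count w (shuffle π [])) (antipode σ)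
  ≡⟨ linExt-cong (antipode σ)
                  (All.universal (λ (_ , π) → cong (count w) (shuffle-[]ʳ π)) (antipode σ)) ⟩
    linExt (λ π → count w (π ∷ [])) (antipode σ)
  ≡⟨ linExt-single w (antipode σ) ⟩
    coeff (antipode σ) w
  ∎
  where open ≡-Reasoning

-- Appending a maximal letter

mrProdW-∷ʳ-max : ∀ {x k} σ π → All (_< x) σ → k ≤ length σ → length π ≡ k →
                 mrProdW π (st (drop k (σ ∷ʳ x))) ≡
                 shuffle π (shiftW k (st (drop k σ)) ∷ʳ suc (length σ))
mrProdW-∷ʳ-max {x} {k} σ π σ<x k≤|σ| refl = cong (shuffle π) (begin
    shiftW k (st (drop k (σ ∷ʳ x)))
  ≡⟨ cong (shiftW k ∘ st) (drop-++ˡ σ (x ∷ []) k≤|σ|) ⟩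
    shiftW k (st (drop k σ ∷ʳ x))
  ≡⟨ cong (shiftW k) (st-∷ʳ (drop k σ) (AllP.drop⁺ k σ<x)) ⟩
    shiftW k (st (drop k σ) ∷ʳ suc (length (drop k σ)))
  ≡⟨ map-++ (_+ k) (st (drop k σ)) _ ⟩
    shiftW k (st (drop k σ)) ∷ʳ suc (length (drop k σ) + k)
  ≡⟨ cong (λ l → shiftW k (st (drop k σ)) ∷ʳ suc (l + k)) (length-drop k σ) ⟩
    shiftW k (st (drop k σ)) ∷ʳ suc (length σ ∸ k + k)
  ≡⟨ cong (λ l → shiftW k (st (drop k σ)) ∷ʳ suc l) (ℕP.m∸n+n≡m k≤|σ|) ⟩
    shiftW k (st (drop k σ)) ∷ʳ suc (length σ)
  ∎)
  where open ≡-Reasoning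

coeff-antipodeTerm-∷ʳ-max : ∀ {x k} σ w → All (_< x) σ → k ≤ length σ →
  coeff (antipodeTerm (σ ∷ʳ x) k) w ≡
  linExt (λ π → count w (shuffle π (shiftW k (st (drop k σ)) ∷ʳ suc (length σ))))
         (antipode (st (take k σ)))
coeff-antipodeTerm-∷ʳ-max {x} {k} σ w σ<x k≤|σ| = begin
    coeff (antipodeTerm (σ ∷ʳ x) k) w
  ≡⟨ coeff-mrProd (antipode (st (take k (σ ∷ʳ x)))) (st (drop k (σ ∷ʳ x))) w ⟩
    linExt (count w ∘ suffix-product) (antipode (st (take k (σ ∷ʳ x))))
  ≡⟨ cong (λ u → linExt (count w ∘ suffix-product) (antipode (st u))) (take-++ˡ σ (x ∷ []) k≤|σ|) ⟩
    linExt (count w ∘ suffix-product) A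
  ≡⟨ linExt-cong A (All.map (λ { {_ , π} (|π|≡k , _) →
                                 cong (count w) (mrProdW-∷ʳ-max σ π σ<x k≤|σ| |π|≡k) })
                            (antipode-st-take-Graded σ k≤|σ|)) ⟩
    linExt (λ π → count w (shuffle π (shiftW k (st (drop k σ)) ∷ʳ suc (length σ)))) A
  ∎
  where
  open ≡-Reasoning
  A = antipode (st (take k σ))
  suffix-product : Word → List Word
  suffix-product π = mrProdW π (st (drop k (σ ∷ʳ x)))

coeff-antipodeTerm-∷ʳ-max-∷ʳ : ∀ {x k} σ w → All (_< x) σ → k ≤ length σ →
  coeff (antipodeTerm (σ ∷ʳ x) k) (w ∷ʳ suc (length σ)) ≡ coeff (antipodeTerm σ k) w
coeff-antipodeTerm-∷ʳ-max-∷ʳ {x} {k} σ w σ<x k≤|σ| = begin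
    coeff (antipodeTerm (σ ∷ʳ x) k) (w ∷ʳ n)
  ≡⟨ coeff-antipodeTerm-∷ʳ-max σ (w ∷ʳ n) σ<x k≤|σ| ⟩
    linExt (λ π → count (w ∷ʳ n) (shuffle π (shiftW k (st (drop k σ)) ∷ʳ n))) A
  ≡⟨ linExt-cong A (All.map (λ { {_ , π} π-graded@(|π|≡k , _) →
       trans (count-shuffle-∷ʳ π _ w (Graded-last≢ π-graded (s≤s k≤|σ|)))
             (cong (λ l → count w (shuffle π (shiftW l (st (drop k σ))))) (sym |π|≡k)) })
       (antipode-st-take-Graded σ k≤|σ|)) ⟩
    linExt (λ π → count w (mrProdW π (st (drop k σ)))) A
  ≡⟨ coeff-mrProd A (st (drop k σ)) w ⟨
    coeff (antipodeTerm σ k) w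
  ∎
  where
  open ≡-Reasoning
  n = suc (length σ)
  A = antipode (st (take k σ))

top-lastPart-vanishes : ∀ {x} σ → 0 < length σ → st σ ≡ σ → All (_< x) σ →
                        IsZeroLC (lastPart (suc (length σ)) (antipode (σ ∷ʳ x)))
top-lastPart-vanishes {x} σ 0<|σ| stσ≡σ σ<x = lastPart-IsZeroLC n (antipode (σ ∷ʳ x)) vanish
  where
  open ≡-Reasoning
  m = length σ
  n = suc m
  partialSum : ℕ → Word → ℤ
  partialSum k w = coeff (concatMap (antipodeTerm σ) (upTo k)) w
  vanish : ∀ w → last w ≡ just n → coeff (antipode (σ ∷ʳ x)) w ≡ 0ℤ
  vanish w w↦n with w′ , refl ← last⇒∷ʳ w w↦n = begin
      coeff (antipode (σ ∷ʳ x)) (w′ ∷ʳ n)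
    ≡⟨ coeff-antipode-∷ʳ σ x (w′ ∷ʳ n) ⟩
      - coeff (concatMap (antipodeTerm (σ ∷ʳ x)) (upTo n)) (w′ ∷ʳ n)
    ≡⟨ cong -_ (coeff-concatMap-cong (antipodeTerm (σ ∷ʳ x)) (antipodeTerm σ) (upTo n)
                 (All.tabulate λ k∈ →
                    coeff-antipodeTerm-∷ʳ-max-∷ʳ σ w′ σ<x (ℕP.≤-pred (∈-upTo⁻ k∈)))) ⟩
      - partialSum n w′
    ≡⟨ cong -_ (trans (cong (λ ks → coeff (concatMap (antipodeTerm σ) ks) w′) (sym (upTo-∷ʳ m)))
                      (coeff-concatMap-∷ʳ (antipodeTerm σ) (upTo m) m w′)) ⟩
      - (partialSum m w′ +ℤ coeff (antipodeTerm σ m) w′)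
    ≡⟨ cong (λ c → - (partialSum m w′ +ℤ c)) (coeff-antipodeTerm-length σ w′ stσ≡σ) ⟩
      - (partialSum m w′ +ℤ coeff (antipode σ) w′)
    ≡⟨ cong (λ c → - (partialSum m w′ +ℤ c)) (coeff-antipode σ w′ 0<|σ|) ⟩
      - (partialSum m w′ +ℤ - partialSum m w′)
    ≡⟨ cong -_ (ℤP.+-inverseʳ (partialSum m w′)) ⟩
      0ℤ
    ∎

lower-lastPart-vanishes : ∀ {x j} σ → All (_< x) σ → j ≤ length σ →
  (∀ k → j ≤ k → k ≤ length σ → IsZeroLC (lastPart j (antipode (st (take k σ))))) →
  IsZeroLC (lastPart j (antipode (σ ∷ʳ x)))
lower-lastPart-vanishes {x} {j} σ σ<x j≤|σ| long-prefixes = lastPart-IsZeroLC j (antipode (σ ∷ʳ x)) vanish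
  where
  open ≡-Reasoning
  n = suc (length σ)
  prefix-vanishes : ∀ {k} → k ≤ length σ → IsZeroLC (lastPart j (antipode (st (take k σ))))
  prefix-vanishes {k} k≤|σ| with k ℕ.<? j
  ... | no k≮j  = long-prefixes k (ℕP.≮⇒≥ k≮j) k≤|σ|
  ... | yes k<j = lastPart-IsZeroLC j A λ w w↦j → coeff-absent w A
        (All.map (λ { {_ , π} π-graded refl → Graded-last≢ π-graded k<j w↦j })
                 (antipode-st-take-Graded σ k≤|σ|))
    where A = antipode (st (take k σ))
  n≢j : ∀ (v : Word) → last (v ∷ʳ n) ≢ just j
  n≢j v v↦j = ℕP.<⇒≢ (s≤s j≤|σ|) (sym (MaybeP.just-injective (trans (sym (last-∷ʳ v n)) v↦j)))
  term-vanishes : ∀ {w k} → last w ≡ just j → k ≤ length σ →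
                  coeff (antipodeTerm (σ ∷ʳ x) k) w ≡ 0ℤ
  term-vanishes {w} {k} w↦j k≤|σ| = begin
      coeff (antipodeTerm (σ ∷ʳ x) k) w
    ≡⟨ coeff-antipodeTerm-∷ʳ-max σ w σ<x k≤|σ| ⟩
      linExt g A
    ≡⟨ linExt-lastPart j g A
         (All.map (λ { {_ , π} _ π↦̸j → count-shuffle-last≢ π _ w π↦̸j (n≢j V) w↦j })
                  (antipode-st-take-Graded σ k≤|σ|)) ⟩
      linExt g (lastPart j A)
    ≡⟨ linExt-IsZeroLC g (lastPart j A) (prefix-vanishes k≤|σ|) ⟩
      0ℤ
    ∎
    where
    A = antipode (st (take k σ))
    V = shiftW k (st (drop k σ))
    g : Word → ℤ
    g π = count w (shuffle π (V ∷ʳ n))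
  vanish : ∀ w → last w ≡ just j → coeff (antipode (σ ∷ʳ x)) w ≡ 0ℤ
  vanish w w↦j = trans (coeff-antipode-∷ʳ σ x w)
    (cong -_ (coeff-concatMap-0 (antipodeTerm (σ ∷ʳ x)) (upTo n)
                                (All.tabulate λ k∈ → term-vanishes w↦j (ℕP.≤-pred (∈-upTo⁻ k∈)))))

-- Permutations of the form p (m+1) (m+2) ⋯ (m+l)

module Block {m} (p : Word) (p↭ : p ↭ interval 1 m) where

  block : ℕ → Word
  block l = p ++ interval (suc m) l

  block-↭ : ∀ l → block l ↭ interval 1 (m + l)
  block-↭ l = subst (block l ↭_) (sym (interval-++ 1 m l)) (++⁺ʳ (interval (suc m) l) p↭)

  length-block : ∀ l → length (block l) ≡ m + l
  length-block l = trans (↭-length (block-↭ l)) (length-interval 1 (m + l))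

  st-block : ∀ l → st (block l) ≡ block l
  st-block l = st-↭-interval (block l) (block-↭ l)

  block-< : ∀ l → All (_< suc (m + l)) (block l)
  block-< l = All.tabulate λ a∈ → below (∈-interval⁻ 1 (m + l) (∈-resp-↭ (block-↭ l) a∈))
    where below : ∀ {a} → ∃[ i ] i < m + l × a ≡ 1 + i → a < suc (m + l)
          below (i , i<m+l , refl) = s≤s i<m+l

  block-suc : ∀ l → block (suc l) ≡ block l ∷ʳ suc (m + l)
  block-suc l = trans (cong (p ++_) (interval-∷ʳ (suc m) l)) (sym (++-assoc p (interval (suc m) l) _))

  st-take-block : ∀ {k l} → k ≤ l → st (take (m + k) (block l)) ≡ block k
  st-take-block {k} {l} k≤l = begin
      st (take (m + k) (block l))           ≡⟨ cong (λ n → st (take (n + k) (block l))) |p|≡m ⟨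
      st (take (length p + k) (block l))    ≡⟨ cong st (take-++ʳ k p (interval (suc m) l)) ⟩
      st (p ++ take k (interval (suc m) l)) ≡⟨ cong (λ u → st (p ++ u)) (take-interval (suc m) k≤l) ⟩
      st (block k)                          ≡⟨ st-block k ⟩
      block k                               ∎
    where
    open ≡-Reasoning
    |p|≡m = trans (↭-length p↭) (length-interval 1 m)

  UpperPartsVanish : ℕ → Set
  UpperPartsVanish l = ∀ j → m < j → j ≤ m + l → IsZeroLC (lastPart j (antipode (block l)))

  upperPartsVanish : 0 < m → ∀ l → UpperPartsVanish l
  upperPartsVanish 0<m = <-rec UpperPartsVanish step
    where
    step : ∀ l → (∀ {l′} → l′ < l → UpperPartsVanish l′) → UpperPartsVanish l
    step zero    _  j m<j j≤m+0 = ⊥-elim (ℕP.<⇒≱ m<j (subst (j ≤_) (ℕP.+-identityʳ m) j≤m+0))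
    step (suc l) IH j m<j j≤m+l+1 rewrite block-suc l with j ℕ.≟ suc (m + l)
    ... | yes refl = subst (λ n → IsZeroLC (lastPart (suc n) (antipode (block l ∷ʳ suc (m + l)))))
                           (length-block l) (top-lastPart-vanishes (block l) 0<|block| (st-block l) (block-< l))
      where 0<|block| = subst (0 <_) (sym (length-block l)) (ℕP.<-≤-trans 0<m (ℕP.m≤m+n m l))
    ... | no j≢ = lower-lastPart-vanishes (block l) (block-< l) j≤|block| long-prefixes
      where
      j≤|block| : j ≤ length (block l)
      j≤|block| = subst (j ≤_) (sym (length-block l))
                        (ℕP.≤-pred (ℕP.≤∧≢⇒< (subst (j ≤_) (ℕP.+-suc m l) j≤m+l+1) j≢))
      long-prefixes : ∀ k → j ≤ k → k ≤ length (block l) →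
                      IsZeroLC (lastPart j (antipode (st (take k (block l)))))
      long-prefixes k j≤k k≤|block| =
        subst (λ n → IsZeroLC (lastPart j (antipode (st (take n (block l)))))) m+[k∸m]≡k
          (subst (λ u → IsZeroLC (lastPart j (antipode u))) (sym (st-take-block k∸m≤l))
                 (IH (s≤s k∸m≤l) j m<j (subst (j ≤_) (sym m+[k∸m]≡k) j≤k)))
        where
        m+[k∸m]≡k = ℕP.m+[n∸m]≡n (ℕP.<⇒≤ (ℕP.<-≤-trans m<j j≤k))
        k∸m≤l = ℕP.+-cancelˡ-≤ m _ l (subst₂ _≤_ (sym m+[k∸m]≡k) (length-block l) k≤|block|)

lemma3p5 : (n i : ℕ) → 2 ≤ i → i ≤ n → (σ : Word) → σ ↭ range 1 n →
           drop (i ∸ 1) σ ≡ range i n →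
           (j : ℕ) → i ≤ j → j ≤ n → IsZeroLC (lastPart j (antipode σ))
lemma3p5 n (suc m) (s≤s 0<m) i≤n σ σ↭ suffix j i≤j j≤n =
  subst (λ u → IsZeroLC (lastPart j (antipode u))) (sym σ≡block)
        (upperPartsVanish 0<m (n ∸ m) j i≤j (subst (j ≤_) (sym m+l≡n) j≤n))
  where
  p = take m σ
  m+l≡n = ℕP.m+[n∸m]≡n (ℕP.≤-trans (ℕP.n≤1+n m) i≤n)
  σ≡block : σ ≡ p ++ interval (suc m) (n ∸ m)
  σ≡block = trans (sym (take++drop≡id m σ)) (cong (p ++_) (trans suffix (range≡interval (suc m) n)))
  range≡split : range 1 n ≡ interval 1 m ++ interval (suc m) (n ∸ m)
  range≡split = trans (range≡interval 1 n) (trans (cong (interval 1) (sym m+l≡n)) (interval-++ 1 m (n ∸ m)))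
  p↭ : p ↭ interval 1 m
  p↭ = ++-cancelʳ-↭ p (interval 1 m) (interval (suc m) (n ∸ m)) (subst₂ _↭_ σ≡block range≡split σ↭)
  open Block p p↭
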